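{- Every $\mathcal{PCO}_{\sigma}$ formula $\varphi$ is equivalent to a $\mathcal{PCO}_{\sigma}$ formula $\varphi'$ such that: (A) all consequents of $\mathrel{\Box\!\!\rightarrow}$ are probabilistic atoms; (B) all consequents of $\supset$ are counterfactuals (formulas of the form $\mathbf X=\mathbf x\mathrel{\Box\!\!\rightarrow}\psi$) or probabilistic atoms. Consequently every $\mathcal{PCO}$ formula is a Boolean combination (using $\land,\sqcup$) of formulas of the forms $\gamma\supset\Pr(\alpha)\vartriangleright t$, $\mathbf X=\mathbf x\mathrel{\Box\!\!\rightarrow}\Pr(\alpha)\vartriangleright t$, and $\gamma\supset(\mathbf X=\mathbf x\mathrel{\Box\!\!\rightarrow}\Pr(\alpha)\vartriangleright t)$, where $\vartriangleright$ is $\geq$ or $>$ and $t$ is a rational $\epsilon\in[0,1]$ or $\Pr(\beta)$.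
   Context: A signature $\sigma=(Dom,Ran)$ is a finite set $Dom$ of variables, each with a finite range. A causal multiteam $T=(T^-,\mathcal{F})$ of signature $\sigma$ consists of a finite multiset $T^-$ of assignments over $Dom$ and a function component $\mathcal{F}$ giving, for each endogenous variable $Y$, a non-constant function $\mathcal{F}_Y$ of the remaining variables, with every row of $T^-$ compatible with these equations; $T$ is recursive (acyclic causal graph). For a consistent conjunction $\mathbf X=\mathbf x$, $T_{\mathbf X=\mathbf x}$ is obtained by setting $\mathbf X$ to $\mathbf x$ in each row, recomputing descendants via $\mathcal{F}$, and removing the equations for $\mathbf X$. $\mathcal{CO}$: $\alpha ::= Y=y \mid Y\neq y \mid \alpha\land\alpha \mid \alpha\lor\alpha \mid \alpha\supset\alpha \mid \mathbf X=\mathbf x \mathrel{\Box\!\!\rightarrow} \alpha$ (the last being the interventionist counterfactual). $\mathcal{PCO}$: $\varphi ::= \eta \mid \varphi\land\varphi \mid \varphi\sqcup\varphi \mid \alpha\supset\varphi \mid \mathbf X=\mathbf x\mathrel{\Box\!\!\rightarrow}\varphi$ with $\alpha\in\mathcal{CO}$, and atoms $\eta$ being literals $Y=y$, $Y\neq y$ or probabilistic atoms $\Pr(\alpha)\geq\epsilon$, $\Pr(\alpha)>\epsilon$, $\Pr(\alpha)\geq\Pr(\beta)$, $\Pr(\alpha)>\Pr(\beta)$ ($\alpha,\beta\in\mathcal{CO}$, $\epsilon\in[0,1]\cap\mathbb Q$). Semantics: literals hold if all rows satisfy them; $\land$ conjunction; $\sqcup$ is Boolean disjunction ($T\models\psi\sqcup\chi$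 iff $T\models\psi$ or $T\models\chi$); $T\models\alpha\supset\varphi$ iff $T^\alpha\models\varphi$, where $T^\alpha$ keeps the rows $s$ with $(\{s\},\mathcal{F})\models\alpha$; $T\models\mathbf X=\mathbf x\mathrel{\Box\!\!\rightarrow}\varphi$ iff $T_{\mathbf X=\mathbf x}\models\varphi$ or $\mathbf X=\mathbf x$ is inconsistent; a probabilistic atom holds iff $T$ is empty or the inequality holds for $P_T(\alpha)=|(T^\alpha)^-|/|T^-|$. Equivalence means satisfaction by the same causal multiteams. -}

module Defs where

open import Data.Nat using (ℕ; zero; suc)
open import Data.Fin using (Fin) renaming (_≟_ to _≟ᶠ_)
open import Data.Bool using (Bool; true; false; _∧_; _∨_; not; if_then_else_)
open import Data.List using (List; []; _∷_; length)
open import Data.List.Relation.Unary.All using (All)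
open import Data.Maybe using (Maybe; just; nothing)
open import Data.Product using (Σ; Σ-syntax; ∃; ∃-syntax; _×_; _,_)
open import Data.Sum using (_⊎_)
open import Data.Unit using (⊤)
open import Data.Integer using (+_)
open import Data.Rational using (ℚ; 0ℚ; 1ℚ; _/_) renaming (_≤_ to _≤ℚ_; _<_ to _<ℚ_)
open import Relation.Binary.PropositionalEquality using (_≡_; _≢_; refl)
open import Relation.Nullary using (yes; no; ¬_)
open import Relation.Nullary.Decidable using (⌊_⌋)

record Signature : Set where
  field
    size : ℕ
    rng  : Fin size → ℕ

module _ (σ : Signature) where
  open Signature σ

  Var : Set
  Var = Fin size

  Val : Var → Set
  Val v = Fin (suc (rng v))

  Assignment : Set
  Assignment = (v : Var) → Val v

  update : Assignment → (v : Var) → Val v → Assignment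
  update s v a w with v ≟ᶠ w
  ... | yes refl = a
  ... | no _ = s w

  -- function component: nothing = exogenous, just f = endogenous with
  -- equation V := f (f must not depend on V itself, see IsCausalMultiteam)
  FunComp : Set
  FunComp = (v : Var) → Maybe (Assignment → Val v)

  -- a (raw) causal multiteam: multiset of rows (a list) + function component
  record Team : Set where
    constructor mkTeam
    field
      rows : List Assignment
      funs : FunComp
  open Team public

  -- conjunctions X = x, as lists of (variable , value) pairs
  Intervention : Set
  Intervention = List (Σ Var Val)

  lookupI : Intervention → (v : Var) → Maybe (Val v)
  lookupI [] v = nothing
  lookupI ((w , b) ∷ r) v with w ≟ᶠ v
  ... | yes refl = just b
  ... | no _ = lookupI r v

  agrees : (v : Var) → Val v → Intervention → Bool
  agrees v a [] = true
  agrees v a ((w , b) ∷ r) with v ≟ᶠ w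
  ... | yes refl = ⌊ a ≟ᶠ b ⌋ ∧ agrees v a r
  ... | no _ = agrees v a r

  consistent : Intervention → Bool
  consistent [] = true
  consistent ((v , a) ∷ r) = agrees v a r ∧ consistent r

  step : FunComp → Intervention → Assignment → Assignment
  step F X s v with lookupI X v
  ... | just a = a
  ... | nothing with F v
  ...   | nothing = s v
  ...   | just f = f s

  iter : ℕ → (Assignment → Assignment) → Assignment → Assignment
  iter zero g s = s
  iter (suc k) g s = iter k g (g s)

  -- the row s after intervention X = x (for recursive systems the
  -- iteration has stabilised after size+1 steps: descendants of X are
  -- recomputed via F, all other values are unchanged)
  doRow : FunComp → Intervention → Assignment → Assignment
  doRow F X s = iter (suc size) (step F X) s

  restrictF : FunComp → Intervention → FunComp
  restrictF F X v with lookupI X v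
  ... | just _ = nothing
  ... | nothing = F v

  intervene : Team → Intervention → Team
  intervene T X = mkTeam (Data.List.map (doRow (funs T) X) (rows T)) (restrictF (funs T) X)

  data CO : Set where
    co=   : (v : Var) → Val v → CO
    co≠   : (v : Var) → Val v → CO
    _∧ᶜ_  : CO → CO → CO
    _∨ᶜ_  : CO → CO → CO
    _⊃ᶜ_  : CO → CO → CO
    _□→ᶜ_ : Intervention → CO → CO

  -- (\{s\}, F) ⊨ α  (on singleton teams CO is classical)
  evalCO : FunComp → Assignment → CO → Bool
  evalCO F s (co= v a) = ⌊ s v ≟ᶠ a ⌋
  evalCO F s (co≠ v a) = not ⌊ s v ≟ᶠ a ⌋
  evalCO F s (α ∧ᶜ β) = evalCO F s α ∧ evalCO F s β
  evalCO F s (α ∨ᶜ β) = evalCO F s α ∨ evalCO F s β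
  evalCO F s (α ⊃ᶜ β) = not (evalCO F s α) ∨ evalCO F s β
  evalCO F s (X □→ᶜ α) =
    if consistent X then evalCO (restrictF F X) (doRow F X s) α else true

  select : (Assignment → Bool) → List Assignment → List Assignment
  select p [] = []
  select p (s ∷ ss) = if p s then s ∷ select p ss else select p ss

  restrictTo : Team → CO → Team
  restrictTo T α = mkTeam (select (λ s → evalCO (funs T) s α) (rows T)) (funs T)

  -- P_T(α) = |(T^α)^-| / |T^-|  (set to 0 for the empty team, where it is unused)
  prob : Team → CO → ℚ
  prob T α with length (rows T)
  ... | zero = 0ℚ
  ... | suc k = (+ length (rows (restrictTo T α))) / suc k

  data PCO : Set where
    lit=   : (v : Var) → Val v → PCO
    lit≠   : (v : Var) → Val v → PCO
    pr≥    : CO → (ε : ℚ) → 0ℚ ≤ℚ ε → ε ≤ℚ 1ℚ → PCO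
    pr>    : CO → (ε : ℚ) → 0ℚ ≤ℚ ε → ε ≤ℚ 1ℚ → PCO
    pr≥pr  : CO → CO → PCO
    pr>pr  : CO → CO → PCO
    _∧ᵖ_   : PCO → PCO → PCO
    _⊔_    : PCO → PCO → PCO
    _⊃_    : CO → PCO → PCO
    _□→_   : Intervention → PCO → PCO

  _⊨_ : Team → PCO → Set
  T ⊨ lit= v a = All (λ s → s v ≡ a) (rows T)
  T ⊨ lit≠ v a = All (λ s → s v ≢ a) (rows T)
  T ⊨ pr≥ α ε _ _ = rows T ≡ [] ⊎ ε ≤ℚ prob T α
  T ⊨ pr> α ε _ _ = rows T ≡ [] ⊎ ε <ℚ prob T α
  T ⊨ pr≥pr α β = rows T ≡ [] ⊎ prob T β ≤ℚ prob T α
  T ⊨ pr>pr α β = rows T ≡ [] ⊎ prob T β <ℚ prob T α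
  T ⊨ (φ ∧ᵖ ψ) = (T ⊨ φ) × (T ⊨ ψ)
  T ⊨ (φ ⊔ ψ) = (T ⊨ φ) ⊎ (T ⊨ ψ)
  T ⊨ (α ⊃ φ) = restrictTo T α ⊨ φ
  T ⊨ (X □→ φ) = consistent X ≡ false ⊎ (intervene T X ⊨ φ)

  Parent : FunComp → Var → Var → Set
  Parent F z y = Σ[ f ∈ (Assignment → Val y) ] (F y ≡ just f ×
                   (∃[ s ] ∃[ a ] f s ≢ f (update s z a)))

  data Path (F : FunComp) : Var → Var → Set where
    edge : ∀ {z y} → Parent F z y → Path F z y
    cons : ∀ {z w y} → Parent F z w → Path F w y → Path F z y

  record IsCausalMultiteam (T : Team) : Set where
    field
      notSelf   : ∀ v f → funs T v ≡ just f → ∀ s a → f s ≡ f (update s v a)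
      nonConst  : ∀ v f → funs T v ≡ just f → ∃[ s ] ∃[ s' ] f s ≢ f s'
      compat    : ∀ v f → funs T v ≡ just f → All (λ s → s v ≡ f s) (rows T)
      acyclic   : ∀ v → ¬ Path (funs T) v v

  _≡ᴾ_ : PCO → PCO → Set
  φ ≡ᴾ ψ = ∀ T → IsCausalMultiteam T → ((T ⊨ φ → T ⊨ ψ) × (T ⊨ ψ → T ⊨ φ))

  data IsProbAtom : PCO → Set where
    pa≥   : ∀ α ε p q → IsProbAtom (pr≥ α ε p q)
    pa>   : ∀ α ε p q → IsProbAtom (pr> α ε p q)
    pa≥pr : ∀ α β → IsProbAtom (pr≥pr α β)
    pa>pr : ∀ α β → IsProbAtom (pr>pr α β)

  data IsCounterfactual : PCO → Set where
    isCf : ∀ X ψ → IsCounterfactual (X □→ ψ)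

  CondA : PCO → Set
  CondA (lit= v a) = ⊤
  CondA (lit≠ v a) = ⊤
  CondA (pr≥ α ε p q) = ⊤
  CondA (pr> α ε p q) = ⊤
  CondA (pr≥pr α β) = ⊤
  CondA (pr>pr α β) = ⊤
  CondA (φ ∧ᵖ ψ) = CondA φ × CondA ψ
  CondA (φ ⊔ ψ) = CondA φ × CondA ψ
  CondA (α ⊃ φ) = CondA φ
  CondA (X □→ φ) = IsProbAtom φ × CondA φ

  CondB : PCO → Set
  CondB (lit= v a) = ⊤
  CondB (lit≠ v a) = ⊤
  CondB (pr≥ α ε p q) = ⊤
  CondB (pr> α ε p q) = ⊤
  CondB (pr≥pr α β) = ⊤
  CondB (pr>pr α β) = ⊤
  CondB (φ ∧ᵖ ψ) = CondB φ × CondB ψ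
  CondB (φ ⊔ ψ) = CondB φ × CondB ψ
  CondB (α ⊃ φ) = (IsCounterfactual φ ⊎ IsProbAtom φ) × CondB φ
  CondB (X □→ φ) = CondB φ

  data BasicForm : PCO → Set where
    bf⊃    : ∀ γ P → IsProbAtom P → BasicForm (γ ⊃ P)
    bf□→   : ∀ X P → IsProbAtom P → BasicForm (X □→ P)
    bf⊃□→  : ∀ γ X P → IsProbAtom P → BasicForm (γ ⊃ (X □→ P))

  data BoolComb : PCO → Set where
    bcBase : ∀ {φ} → BasicForm φ → BoolComb φ
    bc∧    : ∀ {φ ψ} → BoolComb φ → BoolComb ψ → BoolComb (φ ∧ᵖ ψ)
    bc⊔    : ∀ {φ ψ} → BoolComb φ → BoolComb ψ → BoolComb (φ ⊔ ψ)

{-# OPTIONS --safe #-}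
-- An intervention keeps the number of rows and commutes with taking subteams,
-- (T_{X=x})^β = (T^{X=x □→ β})_{X=x}.  Hence, after a stack of consistent
-- interventions has been applied to a subteam T^γ, emptiness is unchanged and
-- every probability Pr(α) equals the probability in T^γ of the counterfactual
-- that prefixes α with those interventions.  A literal Y = y holds iff the
-- subteam of rows with Y ≠ y is empty, and emptiness of a team is expressed by
-- the atom Pr(γ) > Pr(γ).  Pushing subteam selections and interventions down to
-- the atoms therefore rewrites every formula into a Boolean combination of
-- formulas γ ⊃ P with P a probabilistic atom, which satisfy (A) and (B).
module Submission where

open import Defs
open import Data.Bool using (Bool; true; false; _∧_; _∨_; not)
open import Data.Empty using (⊥-elim)
open import Data.Fin using () renaming (_≟_ to _≟ᶠ_)
open import Data.Integer using (+_)
open import Data.List using (List; []; _∷_; length; map)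
open import Data.List.Properties using (length-map)
open import Data.List.Relation.Unary.All using (All; []; _∷_)
open import Data.Nat using (ℕ; zero; suc)
open import Data.Product using (Σ-syntax; _×_; _,_)
open import Data.Product.Function.NonDependent.Propositional using (_×-⇔_)
open import Data.Rational using (ℚ; 0ℚ; _/_) renaming (_≤_ to _≤ℚ_; _<_ to _<ℚ_)
open import Data.Rational.Properties using (≤-refl; <-irrefl)
open import Data.Sum using (_⊎_; inj₁; inj₂)
open import Data.Sum.Function.Propositional using (_⊎-⇔_)
open import Data.Unit using (tt)
open import Function using (_∘_)
open import Function.Bundles using (_⇔_; mk⇔; Equivalence)
open import Function.Construct.Symmetry using (⇔-sym)
open import Function.Related.Propositional using (≡⇒; K-trans; equivalence; module EquationalReasoning)
open import Relation.Binary.PropositionalEquality using (_≡_; _≢_; refl; sym; trans; cong; cong₂; module ≡-Reasoning)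
open import Relation.Nullary using (yes; no)

≡[]-⇔-≡[] : ∀ {a b} {A : Set a} {B : Set b} (xs : List A) (ys : List B) →
  length xs ≡ length ys → (xs ≡ []) ⇔ (ys ≡ [])
≡[]-⇔-≡[] []       []       _  = mk⇔ (λ _ → refl) (λ _ → refl)
≡[]-⇔-≡[] (_ ∷ _)  (_ ∷ _)  _  = mk⇔ (λ ()) (λ ())

module _ {σ : Signature} where

  select-cong : ∀ {p q : Assignment σ → Bool} → (∀ s → p s ≡ q s) →
    ∀ ss → select σ p ss ≡ select σ q ss
  select-cong         p≗q []       = refl
  select-cong {q = q} p≗q (s ∷ ss) rewrite p≗q s with q s
  ... | true  = cong (s ∷_) (select-cong p≗q ss)
  ... | false = select-cong p≗q ss

  select-map : ∀ (p : Assignment σ → Bool) f ss →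
    select σ p (map f ss) ≡ map f (select σ (p ∘ f) ss)
  select-map p f []       = refl
  select-map p f (s ∷ ss) with p (f s)
  ... | true  = cong (f s ∷_) (select-map p f ss)
  ... | false = select-map p f ss

  select-select : ∀ (p q : Assignment σ → Bool) ss →
    select σ p (select σ q ss) ≡ select σ (λ s → q s ∧ p s) ss
  select-select p q []       = refl
  select-select p q (s ∷ ss) with q s
  ... | false = select-select p q ss
  ... | true with p s
  ...   | true  = cong (s ∷_) (select-select p q ss)
  ...   | false = select-select p q ss

  select-true : ∀ (p : Assignment σ → Bool) → (∀ s → p s ≡ true) →
    ∀ ss → select σ p ss ≡ ss
  select-true p p≡true []       = refl
  select-true p p≡true (s ∷ ss) rewrite p≡true s = cong (s ∷_) (select-true p p≡true ss)

  All-≡⇔select-≠-empty : ∀ F v a ss →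
    All (λ s → s v ≡ a) ss ⇔ (select σ (λ s → evalCO σ F s (co≠ v a)) ss ≡ [])
  All-≡⇔select-≠-empty F v a []       = mk⇔ (λ _ → refl) (λ _ → [])
  All-≡⇔select-≠-empty F v a (s ∷ ss) with s v ≟ᶠ a
  ... | yes eq = mk⇔ (λ { (_ ∷ rest) → Equivalence.to (All-≡⇔select-≠-empty F v a ss) rest })
                     (λ empty → eq ∷ Equivalence.from (All-≡⇔select-≠-empty F v a ss) empty)
  ... | no neq = mk⇔ (λ { (eq ∷ _) → ⊥-elim (neq eq) }) (λ ())

  All-≢⇔select-=-empty : ∀ F v a ss →
    All (λ s → s v ≢ a) ss ⇔ (select σ (λ s → evalCO σ F s (co= v a)) ss ≡ [])
  All-≢⇔select-=-empty F v a []       = mk⇔ (λ _ → refl) (λ _ → [])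
  All-≢⇔select-=-empty F v a (s ∷ ss) with s v ≟ᶠ a
  ... | yes eq = mk⇔ (λ { (neq ∷ _) → ⊥-elim (neq eq) }) (λ ())
  ... | no neq = mk⇔ (λ { (_ ∷ rest) → Equivalence.to (All-≢⇔select-=-empty F v a ss) rest })
                     (λ empty → neq ∷ Equivalence.from (All-≢⇔select-=-empty F v a ss) empty)

  length-intervene : ∀ T X → length (rows (intervene σ T X)) ≡ length (rows T)
  length-intervene T X = length-map (doRow σ (funs T) X) (rows T)

  restrictTo-intervene : ∀ T X β → consistent σ X ≡ true →
    restrictTo σ (intervene σ T X) β ≡ intervene σ (restrictTo σ T (X □→ᶜ β)) X
  restrictTo-intervene T X β consistentX =
    cong (λ ss → mkTeam ss (restrictF σ (funs T) X))
      (trans (select-map _ (doRow σ (funs T) X) (rows T))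
             (cong (map (doRow σ (funs T) X)) (select-cong eval-□→ᶜ (rows T))))
    where
    eval-□→ᶜ : ∀ s → evalCO σ (restrictF σ (funs T) X) (doRow σ (funs T) X s) β
                     ≡ evalCO σ (funs T) s (X □→ᶜ β)
    eval-□→ᶜ s rewrite consistentX = refl

  restrictTo-restrictTo : ∀ T γ δ → restrictTo σ (restrictTo σ T γ) δ ≡ restrictTo σ T (γ ∧ᶜ δ)
  restrictTo-restrictTo T γ δ = cong (λ ss → mkTeam ss (funs T)) (select-select _ _ (rows T))

  restrictTo-⊃ᶜ-self : ∀ T c → restrictTo σ T (c ⊃ᶜ c) ≡ T
  restrictTo-⊃ᶜ-self T c = cong (λ ss → mkTeam ss (funs T)) (select-true _ excluded-middle (rows T))
    where
    excluded-middle : ∀ s → not (evalCO σ (funs T) s c) ∨ evalCO σ (funs T) s c ≡ true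
    excluded-middle s with evalCO σ (funs T) s c
    ... | true  = refl
    ... | false = refl

  frequency : ℕ → ℕ → ℚ
  frequency zero    _ = 0ℚ
  frequency (suc n) m = (+ m) / suc n

  prob≡frequency : ∀ T α → prob σ T α ≡ frequency (length (rows T)) (length (rows (restrictTo σ T α)))
  prob≡frequency T α with length (rows T)
  ... | zero  = refl
  ... | suc n = refl

  ⊨pr>pr-self⇔empty : ∀ T γ → (_⊨_ σ T (pr>pr γ γ)) ⇔ (rows T ≡ [])
  ⊨pr>pr-self⇔empty T γ = mk⇔ (λ { (inj₁ empty) → empty ; (inj₂ p<p) → ⊥-elim (<-irrefl refl p<p) }) inj₁

  -- The head of the list is the intervention applied last (the innermost antecedent).
  intervene⋆ : Team σ → List (Intervention σ) → Team σ
  intervene⋆ T []       = T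
  intervene⋆ T (X ∷ Xs) = intervene σ (intervene⋆ T Xs) X

  _□→ᶜ⋆_ : List (Intervention σ) → CO σ → CO σ
  []       □→ᶜ⋆ α = α
  (X ∷ Xs) □→ᶜ⋆ α = Xs □→ᶜ⋆ (X □→ᶜ α)

  AllConsistent : List (Intervention σ) → Set
  AllConsistent = All (λ X → consistent σ X ≡ true)

  length-intervene⋆ : ∀ T Xs → length (rows (intervene⋆ T Xs)) ≡ length (rows T)
  length-intervene⋆ T []       = refl
  length-intervene⋆ T (X ∷ Xs) = trans (length-intervene (intervene⋆ T Xs) X) (length-intervene⋆ T Xs)

  empty⇔empty-intervene⋆ : ∀ T Xs → (rows T ≡ []) ⇔ (rows (intervene⋆ T Xs) ≡ [])
  empty⇔empty-intervene⋆ T Xs = ≡[]-⇔-≡[] (rows T) (rows (intervene⋆ T Xs)) (sym (length-intervene⋆ T Xs))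

  restrictTo-intervene⋆ : ∀ Xs → AllConsistent Xs → ∀ T β →
    restrictTo σ (intervene⋆ T Xs) β ≡ intervene⋆ (restrictTo σ T (Xs □→ᶜ⋆ β)) Xs
  restrictTo-intervene⋆ []       []       T β = refl
  restrictTo-intervene⋆ (X ∷ Xs) (c ∷ cs) T β =
    trans (restrictTo-intervene (intervene⋆ T Xs) X β c)
          (cong (λ U → intervene σ U X) (restrictTo-intervene⋆ Xs cs T (X □→ᶜ β)))

  restrictTo-intervene⋆-restrictTo : ∀ Xs → AllConsistent Xs → ∀ T γ δ →
    restrictTo σ (intervene⋆ (restrictTo σ T γ) Xs) δ ≡ intervene⋆ (restrictTo σ T (γ ∧ᶜ (Xs □→ᶜ⋆ δ))) Xs
  restrictTo-intervene⋆-restrictTo Xs cs T γ δ =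
    trans (restrictTo-intervene⋆ Xs cs (restrictTo σ T γ) δ)
          (cong (λ U → intervene⋆ U Xs) (restrictTo-restrictTo T γ (Xs □→ᶜ⋆ δ)))

  prob-intervene⋆ : ∀ Xs → AllConsistent Xs → ∀ T α →
    prob σ (intervene⋆ T Xs) α ≡ prob σ T (Xs □→ᶜ⋆ α)
  prob-intervene⋆ Xs cs T α = begin
    prob σ (intervene⋆ T Xs) α
      ≡⟨ prob≡frequency (intervene⋆ T Xs) α ⟩
    frequency (length (rows (intervene⋆ T Xs))) (length (rows (restrictTo σ (intervene⋆ T Xs) α)))
      ≡⟨ cong₂ frequency (length-intervene⋆ T Xs) (cong (length ∘ rows) (restrictTo-intervene⋆ Xs cs T α)) ⟩
    frequency (length (rows T)) (length (rows (intervene⋆ (restrictTo σ T (Xs □→ᶜ⋆ α)) Xs)))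
      ≡⟨ cong (frequency (length (rows T))) (length-intervene⋆ (restrictTo σ T (Xs □→ᶜ⋆ α)) Xs) ⟩
    frequency (length (rows T)) (length (rows (restrictTo σ T (Xs □→ᶜ⋆ α))))
      ≡⟨ prob≡frequency T (Xs □→ᶜ⋆ α) ⟨
    prob σ T (Xs □→ᶜ⋆ α) ∎
    where open ≡-Reasoning

  ⊨pr≥pr-self : ∀ T γ → _⊨_ σ T (pr≥pr γ γ)
  ⊨pr≥pr-self T γ = inj₂ ≤-refl

  empty-restrictTo-intervene⋆ : ∀ Xs → AllConsistent Xs → ∀ T γ β →
    (_⊨_ σ (restrictTo σ T (γ ∧ᶜ (Xs □→ᶜ⋆ β))) (pr>pr γ γ))
      ⇔ (rows (restrictTo σ (intervene⋆ (restrictTo σ T γ) Xs) β) ≡ [])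
  empty-restrictTo-intervene⋆ Xs cs T γ β = begin
    _⊨_ σ (restrictTo σ T (γ ∧ᶜ (Xs □→ᶜ⋆ β))) (pr>pr γ γ)
      ∼⟨ ⊨pr>pr-self⇔empty _ γ ⟩
    rows (restrictTo σ T (γ ∧ᶜ (Xs □→ᶜ⋆ β))) ≡ []
      ∼⟨ empty⇔empty-intervene⋆ _ Xs ⟩
    rows (intervene⋆ (restrictTo σ T (γ ∧ᶜ (Xs □→ᶜ⋆ β))) Xs) ≡ []
      ≡⟨ cong (λ U → rows U ≡ []) (restrictTo-intervene⋆-restrictTo Xs cs T γ β) ⟨
    rows (restrictTo σ (intervene⋆ (restrictTo σ T γ) Xs) β) ≡ [] ∎
    where open EquationalReasoning

  normalise : List (Intervention σ) → CO σ → PCO σ → PCO σ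
  normalise Xs γ (lit= v a)    = (γ ∧ᶜ (Xs □→ᶜ⋆ co≠ v a)) ⊃ pr>pr γ γ
  normalise Xs γ (lit≠ v a)    = (γ ∧ᶜ (Xs □→ᶜ⋆ co= v a)) ⊃ pr>pr γ γ
  normalise Xs γ (pr≥ α ε p q) = γ ⊃ pr≥ (Xs □→ᶜ⋆ α) ε p q
  normalise Xs γ (pr> α ε p q) = γ ⊃ pr> (Xs □→ᶜ⋆ α) ε p q
  normalise Xs γ (pr≥pr α β)   = γ ⊃ pr≥pr (Xs □→ᶜ⋆ α) (Xs □→ᶜ⋆ β)
  normalise Xs γ (pr>pr α β)   = γ ⊃ pr>pr (Xs □→ᶜ⋆ α) (Xs □→ᶜ⋆ β)
  normalise Xs γ (φ ∧ᵖ ψ)      = normalise Xs γ φ ∧ᵖ normalise Xs γ ψ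
  normalise Xs γ (φ ⊔ ψ)       = normalise Xs γ φ ⊔ normalise Xs γ ψ
  normalise Xs γ (δ ⊃ φ)       = normalise Xs (γ ∧ᶜ (Xs □→ᶜ⋆ δ)) φ
  normalise Xs γ (X □→ φ) with consistent σ X
  ... | true  = normalise (X ∷ Xs) γ φ
  ... | false = γ ⊃ pr≥pr γ γ

  normalise-correct : ∀ Xs → AllConsistent Xs → ∀ γ φ T →
    (_⊨_ σ T (normalise Xs γ φ)) ⇔ (_⊨_ σ (intervene⋆ (restrictTo σ T γ) Xs) φ)
  normalise-correct Xs cs γ (lit= v a) T =
    K-trans (empty-restrictTo-intervene⋆ Xs cs T γ (co≠ v a))
            (⇔-sym (All-≡⇔select-≠-empty (funs V) v a (rows V)))
    where V = intervene⋆ (restrictTo σ T γ) Xs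
  normalise-correct Xs cs γ (lit≠ v a) T =
    K-trans (empty-restrictTo-intervene⋆ Xs cs T γ (co= v a))
            (⇔-sym (All-≢⇔select-=-empty (funs V) v a (rows V)))
    where V = intervene⋆ (restrictTo σ T γ) Xs
  normalise-correct Xs cs γ (pr≥ α ε _ _) T =
    empty⇔empty-intervene⋆ (restrictTo σ T γ) Xs
      ⊎-⇔ ≡⇒ {k = equivalence} (cong (ε ≤ℚ_) (sym (prob-intervene⋆ Xs cs (restrictTo σ T γ) α)))
  normalise-correct Xs cs γ (pr> α ε _ _) T =
    empty⇔empty-intervene⋆ (restrictTo σ T γ) Xs
      ⊎-⇔ ≡⇒ {k = equivalence} (cong (ε <ℚ_) (sym (prob-intervene⋆ Xs cs (restrictTo σ T γ) α)))
  normalise-correct Xs cs γ (pr≥pr α β) T =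
    empty⇔empty-intervene⋆ (restrictTo σ T γ) Xs
      ⊎-⇔ ≡⇒ {k = equivalence} (cong₂ _≤ℚ_ (sym (prob-intervene⋆ Xs cs (restrictTo σ T γ) β))
                                           (sym (prob-intervene⋆ Xs cs (restrictTo σ T γ) α)))
  normalise-correct Xs cs γ (pr>pr α β) T =
    empty⇔empty-intervene⋆ (restrictTo σ T γ) Xs
      ⊎-⇔ ≡⇒ {k = equivalence} (cong₂ _<ℚ_ (sym (prob-intervene⋆ Xs cs (restrictTo σ T γ) β))
                                           (sym (prob-intervene⋆ Xs cs (restrictTo σ T γ) α)))
  normalise-correct Xs cs γ (φ ∧ᵖ ψ) T = normalise-correct Xs cs γ φ T ×-⇔ normalise-correct Xs cs γ ψ T
  normalise-correct Xs cs γ (φ ⊔ ψ)  T = normalise-correct Xs cs γ φ T ⊎-⇔ normalise-correct Xs cs γ ψ T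
  normalise-correct Xs cs γ (δ ⊃ φ)  T =
    K-trans (normalise-correct Xs cs (γ ∧ᶜ (Xs □→ᶜ⋆ δ)) φ T)
            (≡⇒ {k = equivalence} (cong (λ U → _⊨_ σ U φ) (sym (restrictTo-intervene⋆-restrictTo Xs cs T γ δ))))
  normalise-correct Xs cs γ (X □→ φ) T with consistent σ X in consistentX
  ... | true  = K-trans (normalise-correct (X ∷ Xs) (consistentX ∷ cs) γ φ T)
                        (mk⇔ inj₂ λ { (inj₁ ()) ; (inj₂ holds) → holds })
  ... | false = mk⇔ (λ _ → inj₁ refl) (λ _ → ⊨pr≥pr-self _ γ)

  normalise-BoolComb : ∀ Xs γ φ → BoolComb σ (normalise Xs γ φ)
  normalise-BoolComb Xs γ (lit= v a)    = bcBase (bf⊃ _ _ (pa>pr _ _))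
  normalise-BoolComb Xs γ (lit≠ v a)    = bcBase (bf⊃ _ _ (pa>pr _ _))
  normalise-BoolComb Xs γ (pr≥ α ε p q) = bcBase (bf⊃ _ _ (pa≥ _ _ _ _))
  normalise-BoolComb Xs γ (pr> α ε p q) = bcBase (bf⊃ _ _ (pa> _ _ _ _))
  normalise-BoolComb Xs γ (pr≥pr α β)   = bcBase (bf⊃ _ _ (pa≥pr _ _))
  normalise-BoolComb Xs γ (pr>pr α β)   = bcBase (bf⊃ _ _ (pa>pr _ _))
  normalise-BoolComb Xs γ (φ ∧ᵖ ψ)      = bc∧ (normalise-BoolComb Xs γ φ) (normalise-BoolComb Xs γ ψ)
  normalise-BoolComb Xs γ (φ ⊔ ψ)       = bc⊔ (normalise-BoolComb Xs γ φ) (normalise-BoolComb Xs γ ψ)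
  normalise-BoolComb Xs γ (δ ⊃ φ)       = normalise-BoolComb Xs (γ ∧ᶜ (Xs □→ᶜ⋆ δ)) φ
  normalise-BoolComb Xs γ (X □→ φ) with consistent σ X
  ... | true  = normalise-BoolComb (X ∷ Xs) γ φ
  ... | false = bcBase (bf⊃ _ _ (pa≥pr _ _))

  IsProbAtom⇒CondA : ∀ {P} → IsProbAtom σ P → CondA σ P
  IsProbAtom⇒CondA (pa≥ _ _ _ _) = tt
  IsProbAtom⇒CondA (pa> _ _ _ _) = tt
  IsProbAtom⇒CondA (pa≥pr _ _)   = tt
  IsProbAtom⇒CondA (pa>pr _ _)   = tt

  IsProbAtom⇒CondB : ∀ {P} → IsProbAtom σ P → CondB σ P
  IsProbAtom⇒CondB (pa≥ _ _ _ _) = tt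
  IsProbAtom⇒CondB (pa> _ _ _ _) = tt
  IsProbAtom⇒CondB (pa≥pr _ _)   = tt
  IsProbAtom⇒CondB (pa>pr _ _)   = tt

  BoolComb⇒CondA : ∀ {φ} → BoolComb σ φ → CondA σ φ
  BoolComb⇒CondA (bcBase (bf⊃ _ _ atom))     = IsProbAtom⇒CondA atom
  BoolComb⇒CondA (bcBase (bf□→ _ _ atom))    = atom , IsProbAtom⇒CondA atom
  BoolComb⇒CondA (bcBase (bf⊃□→ _ _ _ atom)) = atom , IsProbAtom⇒CondA atom
  BoolComb⇒CondA (bc∧ φ ψ)                   = BoolComb⇒CondA φ , BoolComb⇒CondA ψ
  BoolComb⇒CondA (bc⊔ φ ψ)                   = BoolComb⇒CondA φ , BoolComb⇒CondA ψ

  BoolComb⇒CondB : ∀ {φ} → BoolComb σ φ → CondB σ φ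
  BoolComb⇒CondB (bcBase (bf⊃ _ _ atom))     = inj₂ atom , IsProbAtom⇒CondB atom
  BoolComb⇒CondB (bcBase (bf□→ _ _ atom))    = IsProbAtom⇒CondB atom
  BoolComb⇒CondB (bcBase (bf⊃□→ _ X P atom)) = inj₁ (isCf X P) , IsProbAtom⇒CondB atom
  BoolComb⇒CondB (bc∧ φ ψ)                   = BoolComb⇒CondB φ , BoolComb⇒CondB ψ
  BoolComb⇒CondB (bc⊔ φ ψ)                   = BoolComb⇒CondB φ , BoolComb⇒CondB ψ

  -- CO σ is empty when σ has no variables, so the tautological guard c ⊃ᶜ c
  -- that starts the normalisation is built from a CO formula taken from φ.
  coFormulaIn : PCO σ → CO σ
  coFormulaIn (lit= v a)    = co= v a
  coFormulaIn (lit≠ v a)    = co= v a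
  coFormulaIn (pr≥ α _ _ _) = α
  coFormulaIn (pr> α _ _ _) = α
  coFormulaIn (pr≥pr α _)   = α
  coFormulaIn (pr>pr α _)   = α
  coFormulaIn (φ ∧ᵖ _)      = coFormulaIn φ
  coFormulaIn (φ ⊔ _)       = coFormulaIn φ
  coFormulaIn (δ ⊃ _)       = δ
  coFormulaIn (_ □→ φ)      = coFormulaIn φ

  normalForm : PCO σ → PCO σ
  normalForm φ = normalise [] (c ⊃ᶜ c) φ
    where c = coFormulaIn φ

  normalForm-≡ᴾ : ∀ φ → _≡ᴾ_ σ φ (normalForm φ)
  normalForm-≡ᴾ φ T _ = Equivalence.from normalForm⇔φ , Equivalence.to normalForm⇔φ
    where
    c = coFormulaIn φ
    normalForm⇔φ : (_⊨_ σ T (normalForm φ)) ⇔ (_⊨_ σ T φ)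
    normalForm⇔φ = K-trans (normalise-correct [] [] (c ⊃ᶜ c) φ T)
                           (≡⇒ {k = equivalence} (cong (λ U → _⊨_ σ U φ) (restrictTo-⊃ᶜ-self T c)))

mainTheorem2 : (σ : Signature) (φ : PCO σ) →
    (Σ[ φ' ∈ PCO σ ] (_≡ᴾ_ σ φ φ' × CondA σ φ' × CondB σ φ'))
    × (Σ[ φ'' ∈ PCO σ ] (_≡ᴾ_ σ φ φ'' × BoolComb σ φ''))
mainTheorem2 σ φ =
  (normalForm φ , normalForm-≡ᴾ φ , BoolComb⇒CondA boolComb , BoolComb⇒CondB boolComb) ,
  (normalForm φ , normalForm-≡ᴾ φ , boolComb)
  where
  boolComb : BoolComb σ (normalForm φ)
  boolComb = normalise-BoolComb [] _ φ
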